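{- Let $l$ be a positive integer and $U=U(P,Q)$ a $\Delta$-regular Lucas sequence. Let $p$ be a prime with $p\nmid Q$ and $\rho_U(p)>l$. Then $v_p(C_{U,l}(n))\geq 0$ for all integers $n\geq1$, where \[ C_{U,l}(n)=\frac{1}{U_{n+1}^l}\cdot\frac{((l+1)n)!_U}{(n!_U)^{l+1}}. \]
   Context: For nonzero integers $P,Q$, $U=U(P,Q)$ is defined by $U_0=0$, $U_1=1$, $U_{n+2}=PU_{n+1}-QU_n$; $\Delta=P^2-4Q$. $U$ is $\Delta$-regular if $U_n\neq0$ for all $n\geq1$, $\gcd(P,Q)=1$ and $\Delta\neq0$. For a prime $p\nmid Q$, the rank of appearance $\rho_U(p)$ is the least integer $n\geq1$ with $p\mid U_n$ (it exists). $n!_U=U_n\cdots U_1$ and $0!_U=1$. $v_p$ is the $p$-adic valuation (extended to nonzero rationals). -}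

module Defs where

open import Data.Nat as ℕ using (ℕ; zero; suc)
open import Data.Nat.Divisibility as ℕD using ()
open import Data.Integer as ℤ using (ℤ; +_; ∣_∣)
open import Data.Integer.Divisibility using (_∣_)
open import Data.Integer.GCD using (gcd)
open import Data.Product using (_×_)
open import Relation.Nullary using (¬_; yes; no)
open import Relation.Binary.PropositionalEquality using (_≡_; _≢_)

U : ℤ → ℤ → ℕ → ℤ
U P Q zero = + 0
U P Q (suc zero) = + 1
U P Q (suc (suc n)) = P ℤ.* U P Q (suc n) ℤ.- Q ℤ.* U P Q n

Δ : ℤ → ℤ → ℤ
Δ P Q = P ℤ.* P ℤ.- + 4 ℤ.* Q

ΔRegular : ℤ → ℤ → Set
ΔRegular P Q = ((n : ℕ) → 1 ℕ.≤ n → U P Q n ≢ + 0) × (gcd P Q ≡ + 1) × (Δ P Q ≢ + 0)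

IsRankOfAppearance : ℤ → ℤ → ℕ → ℕ → Set
IsRankOfAppearance P Q p r =
  (1 ℕ.≤ r) × (+ p ∣ U P Q r) × ((m : ℕ) → 1 ℕ.≤ m → m ℕ.< r → ¬ (+ p ∣ U P Q m))

fact : ℤ → ℤ → ℕ → ℤ
fact P Q zero = + 1
fact P Q (suc n) = U P Q (suc n) ℤ.* fact P Q n

-- p-adic valuation of a natural number (with fuel; fuel = m suffices).
-- Conventions: vℕ p 0 = 0 and vℕ p m = 0 for p ≤ 1 (never used in the theorem).
vAux : ℕ → ℕ → ℕ → ℕ
vAux zero p m = 0
vAux (suc f) zero m = 0
vAux (suc f) (suc zero) m = 0
vAux (suc f) (suc (suc q)) zero = 0
vAux (suc f) (suc (suc q)) (suc m) with suc (suc q) ℕD.∣? suc m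
... | yes _ = suc (vAux f (suc (suc q)) (suc m ℕ./ suc (suc q)))
... | no _ = 0

vℕ : ℕ → ℕ → ℕ
vℕ p m = vAux m p m

vℤ : ℕ → ℤ → ℕ
vℤ p x = vℕ p ∣ x ∣

vFrac : ℕ → ℤ → ℤ → ℤ
vFrac p a b = + vℤ p a ℤ.- + vℤ p b

Cnum : ℤ → ℤ → ℕ → ℕ → ℤ
Cnum P Q l n = fact P Q (suc l ℕ.* n)

Cden : ℤ → ℤ → ℕ → ℕ → ℤ
Cden P Q l n = (U P Q (suc n) ℤ.^ l) ℤ.* (fact P Q n ℤ.^ suc l)

-- With w k = v_p(U_k), v_p(C_{U,l}(n)) = Σ_{k ≤ (l+1)n} w k − l·w(n+1) − (l+1)·Σ_{k ≤ n} w k.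
-- Writing w k = Σ_{e ≥ 1} [p^e ∣ U_k] (Legendre's trick) splits this into one count for each e.
-- Since p ∤ Q, the addition formula U_{a+1+c} = U_{a+1} U_{c+1} − Q U_a U_c makes the set
-- {k ≥ 1 | p^e ∣ U_k} closed under multiples and differences, so it is empty or the set of
-- multiples of its least element s, and s ≥ ρ_U(p) > l. For the multiples of s the count is
-- ⌊(l+1)n/s⌋ − l·[s ∣ n+1] − (l+1)⌊n/s⌋ ≥ 0, where the case s ∣ n+1 uses s ≥ l+1.

module Submission where

open import Defs
open import Data.Nat as ℕ using (ℕ; zero; suc; 2+; _≤_; _<_; z≤n; s≤s)
open import Data.Nat.Properties
open import Data.Nat.Primality using (Prime; euclidsLemma)
open import Data.Integer as ℤ using (ℤ; +_; ∣_∣; _≥_)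
import Data.Integer.Properties as ℤ
open import Data.Product using (Σ; ∃; ∃₂; _×_; _,_; proj₁; proj₂)
open import Data.Sum using (_⊎_; inj₁; inj₂; [_,_]′)
open import Function using (_∘_)
open import Relation.Nullary using (¬_; Dec; yes; no; contradiction)
open import Relation.Binary.PropositionalEquality

module LegendreCounting where
  open import Data.Nat using (_+_; _*_; _⊓_; _≤?_; NonZero; >-nonZero⁻¹)
  open import Data.Nat.Tactic.RingSolver using (solve-∀)
  open import Algebra.Properties.CommutativeSemigroup +-commutativeSemigroup
    using () renaming (interchange to +-interchange)
  open import Level using (0ℓ)
  open import Relation.Unary using (Pred; Decidable)
  open import Data.Nat.Divisibility using (_∣_; _∣?_; divides; m%n≡0⇒n∣m)
  open import Data.Nat.DivMod using (_%_; _/_; m≡m%n+[m/n]*n; m%n<n)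

  indicator : {A : Set} → Dec A → ℕ
  indicator (yes _) = 1
  indicator (no _)  = 0

  indicator-cong : {A B : Set} (a? : Dec A) (b? : Dec B) → (A → B) → (B → A) →
                   indicator a? ≡ indicator b?
  indicator-cong (yes _) (yes _) _   _   = refl
  indicator-cong (no _)  (no _)  _   _   = refl
  indicator-cong (yes a) (no ¬b) a→b _   = contradiction (a→b a) ¬b
  indicator-cong (no ¬a) (yes b) _   b→a = contradiction (b→a b) ¬a

  indicator-¬ : {A : Set} (a? : Dec A) → ¬ A → indicator a? ≡ 0
  indicator-¬ (yes a) ¬a = contradiction a ¬a
  indicator-¬ (no _)  _  = refl

  -- sumTo f N = f 1 + ⋯ + f N; the value f 0 never enters.
  sumTo : (ℕ → ℕ) → ℕ → ℕ
  sumTo f zero    = 0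
  sumTo f (suc N) = f (suc N) + sumTo f N

  module _ {f g : ℕ → ℕ} where

    sumTo-cong : ∀ N → (∀ k → 1 ≤ k → k ≤ N → f k ≡ g k) → sumTo f N ≡ sumTo g N
    sumTo-cong zero    _   = refl
    sumTo-cong (suc N) f≗g =
      cong₂ _+_ (f≗g (suc N) (s≤s z≤n) ≤-refl) (sumTo-cong N λ k 1≤k k≤N → f≗g k 1≤k (m≤n⇒m≤1+n k≤N))

    sumTo-+ : ∀ N → sumTo (λ k → f k + g k) N ≡ sumTo f N + sumTo g N
    sumTo-+ zero    = refl
    sumTo-+ (suc N) = begin
      (f (suc N) + g (suc N)) + sumTo (λ k → f k + g k) N
        ≡⟨ cong₂ _+_ refl (sumTo-+ N) ⟩
      (f (suc N) + g (suc N)) + (sumTo f N + sumTo g N)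
        ≡⟨ +-interchange (f (suc N)) (g (suc N)) (sumTo f N) (sumTo g N) ⟩
      (f (suc N) + sumTo f N) + (g (suc N) + sumTo g N) ∎
      where open ≡-Reasoning

  sumTo-0 : ∀ N → sumTo (λ _ → 0) N ≡ 0
  sumTo-0 zero    = refl
  sumTo-0 (suc N) = sumTo-0 N

  ≤-sumTo : ∀ f {k} N → 1 ≤ k → k ≤ N → f k ≤ sumTo f N
  ≤-sumTo f zero    1≤k k≤0 = contradiction (≤-trans 1≤k k≤0) λ ()
  ≤-sumTo f {k} (suc N) 1≤k k≤1+N with m≤n⇒m<n∨m≡n k≤1+N
  ... | inj₁ k<1+N  = ≤-trans (≤-sumTo f N 1≤k (≤-pred k<1+N)) (m≤n+m (sumTo f N) (f (suc N)))
  ... | inj₂ refl   = m≤m+n (f k) (sumTo f N)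

  sumTo-indicator-≤ : ∀ c E → sumTo (λ e → indicator (e ≤? c)) E ≡ E ⊓ c
  sumTo-indicator-≤ c zero = refl
  sumTo-indicator-≤ c (suc E) with suc E ≤? c
  ... | yes 1+E≤c rewrite sumTo-indicator-≤ c E
    | m≤n⇒m⊓n≡m 1+E≤c | m≤n⇒m⊓n≡m (≤-trans (n≤1+n E) 1+E≤c) = refl
  ... | no 1+E≰c  rewrite sumTo-indicator-≤ c E
    | m≥n⇒m⊓n≡n (≤-pred (≰⇒> 1+E≰c)) | m≥n⇒m⊓n≡n (m≤n⇒m≤1+n (≤-pred (≰⇒> 1+E≰c))) = refl

  multiples : ℕ → ℕ → ℕ
  multiples s = sumTo (λ k → indicator (s ∣? k))

  module _ (s : ℕ) .{{_ : NonZero s}} where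

    multiples-floor : ∀ M → multiples s M * s ≤ M × M < suc (multiples s M) * s
    multiples-floor zero = z≤n , subst (0 <_) (sym (*-identityˡ s)) (>-nonZero⁻¹ s)
    multiples-floor (suc M) with multiples-floor M | s ∣? suc M
    ... | c*s≤M , M<[1+c]*s | yes (divides t 1+M≡t*s) =
      ≤-trans (*-monoˡ-≤ s c<t) (≤-reflexive (sym 1+M≡t*s)) ,
      ≤-trans (s≤s M<[1+c]*s) (+-monoˡ-≤ _ (>-nonZero⁻¹ s))
      where
      c<t : multiples s M < t
      c<t = *-cancelʳ-< s _ _ (≤-<-trans c*s≤M (≤-reflexive 1+M≡t*s))
    ... | c*s≤M , M<[1+c]*s | no s∤1+M =
      m≤n⇒m≤1+n c*s≤M , ≤∧≢⇒< M<[1+c]*s λ 1+M≡[1+c]*s → s∤1+M (divides (suc (multiples s M)) 1+M≡[1+c]*s)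

    ≤-multiples : ∀ {X} M → X * s ≤ M → X ≤ multiples s M
    ≤-multiples {X} M X*s≤M =
      ≤-pred (*-cancelʳ-< s X _ (≤-<-trans X*s≤M (proj₂ (multiples-floor M))))

  -- For f k = v_p(U_k) this is v_p(C_{U,l}(n)) ≥ 0, written without subtraction.
  Balanced : ℕ → ℕ → (ℕ → ℕ) → Set
  Balanced l n f = l * f (suc n) + suc l * sumTo f n ≤ sumTo f (suc l * n)

  module _ {l n : ℕ} where

    Balanced-cong : ∀ {f g} → n < suc l * n → (∀ k → 1 ≤ k → k ≤ suc l * n → f k ≡ g k) →
                    Balanced l n f → Balanced l n g
    Balanced-cong {f} {g} n<N f≗g = subst₂ _≤_ lhs (sumTo-cong _ f≗g)
      where
      lhs : l * f (suc n) + suc l * sumTo f n ≡ l * g (suc n) + suc l * sumTo g n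
      lhs = cong₂ (λ a b → l * a + suc l * b) (f≗g (suc n) (s≤s z≤n) n<N)
                  (sumTo-cong n λ k 1≤k k≤n → f≗g k 1≤k (≤-trans k≤n (<⇒≤ n<N)))

    Balanced-0 : Balanced l n (λ _ → 0)
    Balanced-0 rewrite sumTo-0 n | *-zeroʳ l = z≤n

    Balanced-+ : ∀ {f g} → Balanced l n f → Balanced l n g → Balanced l n (λ k → f k + g k)
    Balanced-+ {f} {g} bal-f bal-g = begin
      l * (f (suc n) + g (suc n)) + suc l * sumTo (λ k → f k + g k) n
        ≡⟨ cong₂ _+_ (*-distribˡ-+ l (f (suc n)) (g (suc n)))
                     (trans (cong (suc l *_) (sumTo-+ n)) (*-distribˡ-+ (suc l) (sumTo f n) (sumTo g n))) ⟩
      (l * f (suc n) + l * g (suc n)) + (suc l * sumTo f n + suc l * sumTo g n)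
        ≡⟨ +-interchange (l * f (suc n)) (l * g (suc n)) (suc l * sumTo f n) (suc l * sumTo g n) ⟩
      (l * f (suc n) + suc l * sumTo f n) + (l * g (suc n) + suc l * sumTo g n)
        ≤⟨ +-mono-≤ bal-f bal-g ⟩
      sumTo f (suc l * n) + sumTo g (suc l * n)
        ≡⟨ sumTo-+ (suc l * n) ⟨
      sumTo (λ k → f k + g k) (suc l * n) ∎
      where open ≤-Reasoning

    Balanced-sumTo : (F : ℕ → ℕ → ℕ) → (∀ e → 1 ≤ e → Balanced l n (F e)) →
                     ∀ E → Balanced l n (λ k → sumTo (λ e → F e k) E)
    Balanced-sumTo F bal zero    = Balanced-0
    Balanced-sumTo F bal (suc E) = Balanced-+ (bal (suc E) (s≤s z≤n)) (Balanced-sumTo F bal E)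

    Balanced-multiples : ∀ s .{{_ : NonZero s}} → l < s → Balanced l n (λ k → indicator (s ∣? k))
    Balanced-multiples s l<s with s ∣? suc n
    ... | no _ = ≤-multiples s (suc l * n) (begin
      (l * 0 + suc l * c) * s ≡⟨ cong (λ x → (x + suc l * c) * s) (*-zeroʳ l) ⟩
      suc l * c * s           ≡⟨ *-assoc (suc l) c s ⟩
      suc l * (c * s)         ≤⟨ *-monoʳ-≤ (suc l) (proj₁ (multiples-floor s n)) ⟩
      suc l * n               ∎)
      where
      open ≤-Reasoning
      c = multiples s n
    ... | yes (divides t 1+n≡t*s) = ≤-multiples s (suc l * n) (+-cancelˡ-≤ s _ _ (begin
      suc (l * 1 + suc l * c) * s ≡⟨ cong (_* s) (shift l c) ⟩
      suc l * suc c * s           ≤⟨ *-monoˡ-≤ s (*-monoʳ-≤ (suc l) c<t) ⟩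
      suc l * t * s               ≡⟨ *-assoc (suc l) t s ⟩
      suc l * (t * s)             ≡⟨ cong (suc l *_) 1+n≡t*s ⟨
      suc l * suc n               ≡⟨ *-suc (suc l) n ⟩
      suc l + suc l * n           ≤⟨ +-monoˡ-≤ (suc l * n) l<s ⟩
      s + suc l * n               ∎))
      where
      open ≤-Reasoning
      c = multiples s n
      c<t : c < t
      c<t = *-cancelʳ-< s c t (≤-<-trans (proj₁ (multiples-floor s n)) (≤-reflexive 1+n≡t*s))
      shift : ∀ l c → suc (l * 1 + suc l * c) ≡ suc l * suc c
      shift = solve-∀

  least-or-none : {D : Pred ℕ 0ℓ} → Decidable D → ∀ M →
    (∀ k → 1 ≤ k → k ≤ M → ¬ D k) ⊎ ∃ λ s → 1 ≤ s × D s × (∀ j → 1 ≤ j → j < s → ¬ D j)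
  least-or-none D? zero = inj₁ λ k 1≤k k≤0 → contradiction (≤-trans 1≤k k≤0) λ ()
  least-or-none {D} D? (suc M) with least-or-none D? M
  ... | inj₂ least = inj₂ least
  ... | inj₁ none with D? (suc M)
  ...   | yes D[1+M] = inj₂ (suc M , s≤s z≤n , D[1+M] , λ j 1≤j j<1+M → none j 1≤j (≤-pred j<1+M))
  ...   | no ¬D[1+M] = inj₁ none′
    where
    none′ : ∀ k → 1 ≤ k → k ≤ suc M → ¬ D k
    none′ k 1≤k k≤1+M with m≤n⇒m<n∨m≡n k≤1+M
    ... | inj₁ k<1+M = none k 1≤k (≤-pred k<1+M)
    ... | inj₂ refl  = ¬D[1+M]

  module _ {D : Pred ℕ 0ℓ}
           (closed-under-multiples : ∀ a t → D a → D (t * a))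
           (closed-under-differences : ∀ a c → D a → D (a + c) → D c) where

    least-divides : ∀ s .{{_ : NonZero s}} → D s → (∀ j → 1 ≤ j → j < s → ¬ D j) →
                    ∀ k → D k → s ∣ k
    least-divides s Ds minimal k Dk with k % s in k%s≡r | D-remainder
      where
      D-remainder : D (k % s)
      D-remainder = closed-under-differences (k / s * s) (k % s) (closed-under-multiples s (k / s) Ds)
                      (subst D (trans (m≡m%n+[m/n]*n k s) (+-comm (k % s) (k / s * s))) Dk)
    ... | zero  | _   = m%n≡0⇒n∣m k s k%s≡r
    ... | suc r | D[1+r] =
      contradiction D[1+r] (minimal (suc r) (s≤s z≤n) (subst (_< s) k%s≡r (m%n<n k s)))

    Balanced-indicator : (D? : Decidable D) → ∀ {l n} → n < suc l * n →
                         (∀ a → 1 ≤ a → D a → l < a) → Balanced l n (λ k → indicator (D? k))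
    Balanced-indicator D? {l} {n} n<N l<D with least-or-none D? (suc l * n)
    ... | inj₁ none =
      Balanced-cong {l} {n} n<N (λ k 1≤k k≤N → sym (indicator-¬ (D? k) (none k 1≤k k≤N)))
        (Balanced-0 {l} {n})
    ... | inj₂ (s@(suc _) , 1≤s , Ds , minimal) =
      Balanced-cong {l} {n} n<N
        (λ k _ _ → indicator-cong (s ∣? k) (D? k) multiple⇒D (least-divides s Ds minimal k))
        (Balanced-multiples s (l<D s 1≤s Ds))
      where
      multiple⇒D : ∀ {k} → s ∣ k → D k
      multiple⇒D (divides t refl) = closed-under-multiples s t Ds

module PAdicValuation (q : ℕ) where
  open import Data.Nat using (_+_; _*_; _^_; _∸_; _⊓_; _≤?_; ≢-nonZero; ≢-nonZero⁻¹)
  open LegendreCounting using (indicator; indicator-cong; sumTo; sumTo-cong; sumTo-indicator-≤)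
  open import Data.Nat.Divisibility using (_∣_; _∣?_; divides; _∣0; ∣-trans; m∣m*n; *-cancelˡ-∣; ∣1⇒≡1)
  open import Data.Nat.DivMod using (_/_; m*n/n≡m)
  open import Data.Nat.Induction using (<-rec)

  -- The base is written 2+ q so that vAux, which pattern-matches on it, computes.
  p : ℕ
  p = 2+ q

  ¬p∣⇒≢0 : ∀ {a} → ¬ p ∣ a → a ≢ 0
  ¬p∣⇒≢0 p∤a refl = p∤a (p ∣0)

  p^[1+k]*a≡p^k*a*p : ∀ k a → p ^ suc k * a ≡ p ^ k * a * p
  p^[1+k]*a≡p^k*a*p k a = trans (*-assoc p (p ^ k) a) (*-comm p (p ^ k * a))

  k<p^k : ∀ k → k < p ^ k
  k<p^k zero    = s≤s z≤n
  k<p^k (suc k) = ≤-<-trans (k<p^k k) (^-monoʳ-< p (s≤s (s≤s z≤n)) (n<1+n k))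

  vAux-¬∣ : ∀ f {x} → x ≢ 0 → ¬ p ∣ x → vAux (suc f) p x ≡ 0
  vAux-¬∣ f {zero}  x≢0 _ = contradiction refl x≢0
  vAux-¬∣ f {suc x} _ p∤x with p ∣? suc x
  ... | yes p∣x = contradiction p∣x p∤x
  ... | no _    = refl

  vAux-∣ : ∀ f {x} → x ≢ 0 → p ∣ x → vAux (suc f) p x ≡ suc (vAux f p (x / p))
  vAux-∣ f {zero}  x≢0 _ = contradiction refl x≢0
  vAux-∣ f {suc x} _ p∣x with p ∣? suc x
  ... | yes _   = refl
  ... | no p∤x  = contradiction p∣x p∤x

  vAux-p^k*a : ∀ f k {a} → ¬ p ∣ a → k < f → vAux f p (p ^ k * a) ≡ k
  vAux-p^k*a (suc f) zero {a} p∤a _ =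
    trans (cong (vAux (suc f) p) (*-identityˡ a)) (vAux-¬∣ f (¬p∣⇒≢0 p∤a) p∤a)
  vAux-p^k*a (suc f) (suc k) {a} p∤a (s≤s k<f) = begin
    vAux (suc f) p (p ^ suc k * a)     ≡⟨ cong (vAux (suc f) p) (p^[1+k]*a≡p^k*a*p k a) ⟩
    vAux (suc f) p (p ^ k * a * p)     ≡⟨ vAux-∣ f p^k*a*p≢0 (divides (p ^ k * a) refl) ⟩
    suc (vAux f p (p ^ k * a * p / p)) ≡⟨ cong (suc ∘ vAux f p) (m*n/n≡m (p ^ k * a) p) ⟩
    suc (vAux f p (p ^ k * a))         ≡⟨ cong suc (vAux-p^k*a f k p∤a k<f) ⟩
    suc k                              ∎
    where
    open ≡-Reasoning
    p^k*a*p≢0 : p ^ k * a * p ≢ 0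
    p^k*a*p≢0 = ≢-nonZero⁻¹ (p ^ k * a * p)
      {{m*n≢0 (p ^ k * a) p {{m*n≢0 (p ^ k) a {{m^n≢0 p k}} {{≢-nonZero (¬p∣⇒≢0 p∤a)}}}}}}

  vℕ-p^k*a : ∀ k {a} → ¬ p ∣ a → vℕ p (p ^ k * a) ≡ k
  vℕ-p^k*a k {a} p∤a =
    vAux-p^k*a (p ^ k * a) k p∤a (<-≤-trans (k<p^k k) (m≤m*n (p ^ k) a {{≢-nonZero (¬p∣⇒≢0 p∤a)}}))

  vℕ-¬∣ : ∀ {a} → ¬ p ∣ a → vℕ p a ≡ 0
  vℕ-¬∣ {a} p∤a = trans (cong (vℕ p) (sym (*-identityˡ a))) (vℕ-p^k*a 0 p∤a)

  vℕ-1 : vℕ p 1 ≡ 0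
  vℕ-1 = vℕ-¬∣ ((λ ()) ∘ ∣1⇒≡1)

  p-free-part : ∀ x → x ≢ 0 → ∃₂ λ k a → ¬ p ∣ a × x ≡ p ^ k * a
  p-free-part = <-rec _ step
    where
    step : ∀ x → (∀ {y} → y < x → y ≢ 0 → ∃₂ λ k a → ¬ p ∣ a × y ≡ p ^ k * a) →
           x ≢ 0 → ∃₂ λ k a → ¬ p ∣ a × x ≡ p ^ k * a
    step x rec x≢0 with p ∣? x
    ... | no p∤x = 0 , x , p∤x , sym (*-identityˡ x)
    ... | yes (divides y refl) with rec (m<m*n y p {{≢-nonZero y≢0}} (s≤s (s≤s z≤n))) y≢0
      where
      y≢0 : y ≢ 0
      y≢0 refl = x≢0 refl
    ...   | k , a , p∤a , refl = suc k , a , p∤a , sym (p^[1+k]*a≡p^k*a*p k a)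

  m^e∣m^k : ∀ m {e k} → e ≤ k → m ^ e ∣ m ^ k
  m^e∣m^k m {e} {k} e≤k = divides (m ^ (k ∸ e))
    (trans (cong (m ^_) (sym (m∸n+n≡m e≤k))) (^-distribˡ-+-* m (k ∸ e) e))

  p^e∣p^k*a⇒e≤k : ∀ {e} k {a} → ¬ p ∣ a → p ^ e ∣ p ^ k * a → e ≤ k
  p^e∣p^k*a⇒e≤k {e} k {a} p∤a p^e∣p^k*a = ≮⇒≥ λ k<e →
    p∤a (*-cancelˡ-∣ (p ^ k) {{m^n≢0 p k}}
          (∣-trans (subst (_∣ p ^ e) (*-comm p (p ^ k)) (m^e∣m^k p k<e)) p^e∣p^k*a))

  p^e∣⇒e≤vℕ : ∀ {e x} → x ≢ 0 → p ^ e ∣ x → e ≤ vℕ p x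
  p^e∣⇒e≤vℕ x≢0 p^e∣x with p-free-part _ x≢0
  ... | k , a , p∤a , refl = subst (_ ≤_) (sym (vℕ-p^k*a k p∤a)) (p^e∣p^k*a⇒e≤k k p∤a p^e∣x)

  e≤vℕ⇒p^e∣ : ∀ {e x} → x ≢ 0 → e ≤ vℕ p x → p ^ e ∣ x
  e≤vℕ⇒p^e∣ x≢0 e≤vx with p-free-part _ x≢0
  ... | k , a , p∤a , refl = ∣-trans (m^e∣m^k p (subst (_ ≤_) (vℕ-p^k*a k p∤a) e≤vx)) (m∣m*n a)

  vℕ≡sumTo-indicator : ∀ {x} E → x ≢ 0 → vℕ p x ≤ E → vℕ p x ≡ sumTo (λ e → indicator (p ^ e ∣? x)) E
  vℕ≡sumTo-indicator {x} E x≢0 vx≤E = begin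
    vℕ p x                                       ≡⟨ m≥n⇒m⊓n≡n vx≤E ⟨
    E ⊓ vℕ p x                                   ≡⟨ sumTo-indicator-≤ (vℕ p x) E ⟨
    sumTo (λ e → indicator (e ≤? vℕ p x)) E      ≡⟨ sumTo-cong E (λ e _ _ →
                                                      indicator-cong _ _ (e≤vℕ⇒p^e∣ x≢0) (p^e∣⇒e≤vℕ x≢0)) ⟩
    sumTo (λ e → indicator (p ^ e ∣? x)) E       ∎
    where open ≡-Reasoning

  module _ (p-prime : Prime p) where

    vℕ-* : ∀ {x y} → x ≢ 0 → y ≢ 0 → vℕ p (x * y) ≡ vℕ p x + vℕ p y
    vℕ-* x≢0 y≢0 with p-free-part _ x≢0 | p-free-part _ y≢0
    ... | k , a , p∤a , refl | j , b , p∤b , refl = begin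
      vℕ p (p ^ k * a * (p ^ j * b))   ≡⟨ cong (vℕ p) regroup ⟩
      vℕ p (p ^ (k + j) * (a * b))     ≡⟨ vℕ-p^k*a (k + j) p∤ab ⟩
      k + j                            ≡⟨ cong₂ _+_ (vℕ-p^k*a k p∤a) (vℕ-p^k*a j p∤b) ⟨
      vℕ p (p ^ k * a) + vℕ p (p ^ j * b) ∎
      where
      open ≡-Reasoning
      regroup : p ^ k * a * (p ^ j * b) ≡ p ^ (k + j) * (a * b)
      regroup = trans ([m*n]*[o*p]≡[m*o]*[n*p] (p ^ k) a (p ^ j) b)
                      (cong (_* (a * b)) (sym (^-distribˡ-+-* p k j)))
      p∤ab : ¬ p ∣ a * b
      p∤ab = [ p∤a , p∤b ]′ ∘ euclidsLemma a b p-prime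

    p∤m⇒p^e∣m*n⇒p^e∣n : ∀ {e m n} → ¬ p ∣ m → p ^ e ∣ m * n → p ^ e ∣ n
    p∤m⇒p^e∣m*n⇒p^e∣n {e} {m} {zero}  _   _         = (p ^ e) ∣0
    p∤m⇒p^e∣m*n⇒p^e∣n {e} {m} {suc n} p∤m p^e∣m*n = e≤vℕ⇒p^e∣ (λ ()) (subst (e ≤_) vₚ[m*n]≡vₚn e≤vₚ[m*n])
      where
      m≢0 = ¬p∣⇒≢0 p∤m
      e≤vₚ[m*n] : e ≤ vℕ p (m * suc n)
      e≤vₚ[m*n] = p^e∣⇒e≤vℕ ([ m≢0 , (λ ()) ]′ ∘ m*n≡0⇒m≡0∨n≡0 m) p^e∣m*n
      vₚ[m*n]≡vₚn : vℕ p (m * suc n) ≡ vℕ p (suc n)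
      vₚ[m*n]≡vₚn = trans (vℕ-* m≢0 (λ ())) (cong (_+ vℕ p (suc n)) (vℕ-¬∣ p∤m))

    vℤ-* : ∀ {x y} → x ≢ + 0 → y ≢ + 0 → vℤ p (x ℤ.* y) ≡ vℤ p x + vℤ p y
    vℤ-* {x} {y} x≢0 y≢0 =
      trans (cong (vℕ p) (ℤ.abs-* x y)) (vℕ-* (x≢0 ∘ ℤ.∣i∣≡0⇒i≡0) (y≢0 ∘ ℤ.∣i∣≡0⇒i≡0))

    vℤ-^ : ∀ {x} → x ≢ + 0 → ∀ m → vℤ p (x ℤ.^ m) ≡ m * vℤ p x
    vℤ-^ x≢0 zero = vℕ-1
    vℤ-^ {x} x≢0 (suc m) =
      trans (vℤ-* x≢0 (x≢0 ∘ ℤ.i^n≡0⇒i≡0 x m)) (cong₂ _+_ refl (vℤ-^ x≢0 m))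

module LucasSequence (P Q : ℤ) where
  open import Data.Nat using (_^_)
  open import Data.Integer using (_*_; _-_; 0ℤ; 1ℤ)
  open import Data.Integer.Divisibility using (_∣_)
  import Data.Integer.Divisibility.Signed as Signed
  open import Data.Integer.Tactic.RingSolver using (solve-∀)
  open import Data.Nat.Divisibility as ℕ using (1∣_; ∣1⇒≡1; m*n∣⇒m∣)

  u : ℕ → ℤ
  u = U P Q

  U-+ : ∀ m n → u (suc m ℕ.+ n) ≡ u (suc m) * u (suc n) - Q * u m * u n
  U-+ zero          n = at-1 Q (u (suc n)) (u n)
    where
    at-1 : ∀ Q x y → x ≡ 1ℤ * x - Q * 0ℤ * y
    at-1 = solve-∀
  U-+ (suc zero)    n = at-2 P Q (u (suc n)) (u n)
    where
    at-2 : ∀ P Q x y → P * x - Q * y ≡ (P * 1ℤ - Q * 0ℤ) * x - Q * 1ℤ * y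
    at-2 = solve-∀
  U-+ (suc (suc m)) n = trans (cong₂ (λ x y → P * x - Q * y) (U-+ (suc m) n) (U-+ m n))
                              (recurrence P Q (u (suc m)) (u m) (u (suc n)) (u n))
    where
    recurrence : ∀ P Q a₁ a₀ x y →
      P * ((P * a₁ - Q * a₀) * x - Q * a₁ * y) - Q * (a₁ * x - Q * a₀ * y)
        ≡ (P * (P * a₁ - Q * a₀) - Q * a₁) * x - Q * (P * a₁ - Q * a₀) * y
    recurrence = solve-∀

  U-∣-U-* : ∀ m t → u m ∣ u (t ℕ.* m)
  U-∣-U-* m t = Signed.∣⇒∣ᵤ (signed m t)
    where
    signed : ∀ m t → u m Signed.∣ u (t ℕ.* m)
    signed zero    t       rewrite *-zeroʳ t = Signed.∣-refl
    signed (suc m) zero    = Signed.divides 0ℤ (sym (ℤ.*-zeroˡ (u (suc m))))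
    signed (suc m) (suc t) = subst (u (suc m) Signed.∣_) (sym (U-+ m (t ℕ.* suc m)))
      (Signed.∣m∣n⇒∣m-n (Signed.∣m⇒∣m*n (u (suc (t ℕ.* suc m))) Signed.∣-refl)
                         (Signed.∣n⇒∣m*n (Q * u m) (signed (suc m) t)))

  module _ (q : ℕ) (p-prime : Prime (2+ q)) (p∤Q : ¬ + 2+ q ∣ Q) where
    open PAdicValuation q using (p; p∤m⇒p^e∣m*n⇒p^e∣n)

    p∣U[1+k]⇒p∤U[k] : ∀ k → + p ∣ u (suc k) → ¬ + p ∣ u k
    p∤Q*U[k]        : ∀ k → + p ∣ u (suc k) → ¬ + p ∣ Q * u k

    p∣U[1+k]⇒p∤U[k] zero    p∣1       _         = contradiction (∣1⇒≡1 p∣1) λ ()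
    p∣U[1+k]⇒p∤U[k] (suc k) p∣U[2+k] p∣U[1+k] = p∤Q*U[k] k p∣U[1+k] (Signed.∣⇒∣ᵤ p∣Q*U[k])
      where
      cancel : ∀ P Q x y → P * x - (P * x - Q * y) ≡ Q * y
      cancel = solve-∀
      p∣Q*U[k] : + p Signed.∣ Q * u k
      p∣Q*U[k] = subst (+ p Signed.∣_) (cancel P Q (u (suc k)) (u k))
        (Signed.∣m∣n⇒∣m-n (Signed.∣n⇒∣m*n P (Signed.∣ᵤ⇒∣ p∣U[1+k])) (Signed.∣ᵤ⇒∣ p∣U[2+k]))

    p∤Q*U[k] k p∣U[1+k] p∣Q*U[k] =
      [ p∤Q , p∣U[1+k]⇒p∤U[k] k p∣U[1+k] ]′
        (euclidsLemma ∣ Q ∣ ∣ u k ∣ p-prime (subst (p ℕ.∣_) (ℤ.abs-* Q (u k)) p∣Q*U[k]))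

    -- U_{a+1} U_{c+1} − U_{a+1+c} = Q U_a U_c, and p ∤ Q U_a when p ∣ U_{a+1}.
    p^e∣U-cancel : ∀ e a c → + (p ^ e) ∣ u a → + (p ^ e) ∣ u (a ℕ.+ c) → + (p ^ e) ∣ u c
    p^e∣U-cancel e       zero    c _ p^e∣U[c] = p^e∣U[c]
    p^e∣U-cancel zero    (suc a) c _ _        = 1∣ _
    p^e∣U-cancel (suc e) (suc a) c p^e∣U[1+a] p^e∣U[1+a+c] =
      p∤m⇒p^e∣m*n⇒p^e∣n p-prime {e = suc e} (p∤Q*U[k] a (m*n∣⇒m∣ p (p ^ e) p^e∣U[1+a]))
        (subst (p ^ suc e ℕ.∣_) (ℤ.abs-* (Q * u a) (u c)) (Signed.∣⇒∣ᵤ p^e∣Q*U[a]*U[c]))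
      where
      cancel : ∀ X Y → X - (X - Y) ≡ Y
      cancel = solve-∀
      p^e∣Q*U[a]*U[c] : + (p ^ suc e) Signed.∣ Q * u a * u c
      p^e∣Q*U[a]*U[c] =
        subst (+ (p ^ suc e) Signed.∣_)
          (trans (cong (u (suc a) * u (suc c) -_) (U-+ a c))
                 (cancel (u (suc a) * u (suc c)) (Q * u a * u c)))
          (Signed.∣m∣n⇒∣m-n (Signed.∣m⇒∣m*n (u (suc c)) (Signed.∣ᵤ⇒∣ {i = u (suc a)} p^e∣U[1+a]))
                             (Signed.∣ᵤ⇒∣ {i = u (suc a ℕ.+ c)} p^e∣U[1+a+c]))

module CatalanValuation (P Q : ℤ) (q : ℕ) (p-prime : Prime (2+ q))
                        (U≢0 : ∀ k → 1 ≤ k → U P Q k ≢ + 0) where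
  open import Data.Nat using (_+_; _*_; _^_)
  open import Data.Integer.Divisibility using (_∣_)
  open import Data.Nat.Divisibility as ℕ using (_∣?_; m*n∣⇒m∣)
  open LegendreCounting
  open PAdicValuation q using (p; vℕ-1; vℤ-*; vℤ-^; vℕ≡sumTo-indicator)
  open LucasSequence P Q using (U-∣-U-*; p^e∣U-cancel)

  vₚU : ℕ → ℕ
  vₚU k = vℤ p (U P Q k)

  fact≢0 : ∀ N → fact P Q N ≢ + 0
  fact≢0 zero    ()
  fact≢0 (suc N) = [ U≢0 (suc N) (s≤s z≤n) , fact≢0 N ]′ ∘ ℤ.i*j≡0⇒i≡0∨j≡0 (U P Q (suc N))

  vℤ-fact : ∀ N → vℤ p (fact P Q N) ≡ sumTo vₚU N
  vℤ-fact zero    = vℕ-1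
  vℤ-fact (suc N) = trans (vℤ-* p-prime (U≢0 (suc N) (s≤s z≤n)) (fact≢0 N)) (cong₂ _+_ refl (vℤ-fact N))

  vℤ-Cden : ∀ l n → vℤ p (Cden P Q l n) ≡ l * vₚU (suc n) + suc l * sumTo vₚU n
  vℤ-Cden l n = begin
    vℤ p (U P Q (suc n) ℤ.^ l ℤ.* fact P Q n ℤ.^ suc l)
      ≡⟨ vℤ-* p-prime (^≢0 U[1+n]≢0 l) (^≢0 (fact≢0 n) (suc l)) ⟩
    vℤ p (U P Q (suc n) ℤ.^ l) + vℤ p (fact P Q n ℤ.^ suc l)
      ≡⟨ cong₂ _+_ (vℤ-^ p-prime U[1+n]≢0 l)
                   (trans (vℤ-^ p-prime (fact≢0 n) (suc l)) (cong (suc l *_) (vℤ-fact n))) ⟩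
    l * vₚU (suc n) + suc l * sumTo vₚU n ∎
    where
    open ≡-Reasoning
    U[1+n]≢0 = U≢0 (suc n) (s≤s z≤n)
    ^≢0 : ∀ {x} → x ≢ + 0 → ∀ m → x ℤ.^ m ≢ + 0
    ^≢0 {x} x≢0 m = x≢0 ∘ ℤ.i^n≡0⇒i≡0 x m

  Balanced-vₚU : ∀ {l n} → ¬ + p ∣ Q → n < suc l * n → (∀ a → 1 ≤ a → + p ∣ U P Q a → l < a) →
                 Balanced l n vₚU
  Balanced-vₚU {l} {n} p∤Q n<N rank>l =
    Balanced-cong {l} {n} n<N layer-cake
      (Balanced-sumTo {l} {n} p^e∣U-indicator Balanced-p^e∣U (sumTo vₚU N))
    where
    N = suc l * n
    p^e∣U-indicator : ℕ → ℕ → ℕ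
    p^e∣U-indicator e k = indicator (p ^ e ∣? ∣ U P Q k ∣)
    Balanced-p^e∣U : ∀ e → 1 ≤ e → Balanced l n (p^e∣U-indicator e)
    Balanced-p^e∣U (suc e) _ =
      Balanced-indicator (λ a t p^e∣Ua → ℕ.∣-trans p^e∣Ua (U-∣-U-* a t))
        (p^e∣U-cancel q p-prime p∤Q (suc e))
        (λ k → p ^ suc e ∣? ∣ U P Q k ∣) {l} {n} n<N
        λ a 1≤a p^e∣Ua → rank>l a 1≤a (m*n∣⇒m∣ p (p ^ e) p^e∣Ua)
    layer-cake : ∀ k → 1 ≤ k → k ≤ N → sumTo (λ e → p^e∣U-indicator e k) (sumTo vₚU N) ≡ vₚU k
    layer-cake k 1≤k k≤N =
      sym (vℕ≡sumTo-indicator (sumTo vₚU N) (U≢0 k 1≤k ∘ ℤ.∣i∣≡0⇒i≡0) (≤-sumTo vₚU N 1≤k k≤N))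

open import Data.Integer.Divisibility using (_∣_)

theorem19 : (l : ℕ) → 1 ≤ l → (P Q : ℤ) → P ≢ + 0 → Q ≢ + 0 → ΔRegular P Q →
    (p : ℕ) → Prime p → ¬ (+ p ∣ Q) →
    (Σ ℕ λ r → IsRankOfAppearance P Q p r × l < r) →
    (n : ℕ) → 1 ≤ n → vFrac p (Cnum P Q l n) (Cden P Q l n) ≥ + 0
theorem19 _ _ _ _ _ _ _ 0 () _ _ _ _
theorem19 _ _ _ _ _ _ _ 1 () _ _ _ _
theorem19 l 1≤l P Q _ _ (U≢0 , _) (2+ q) p-prime p∤Q (r , (_ , _ , below-rank) , l<r) n 1≤n =
  ℤ.i≤j⇒0≤j-i (ℤ.+≤+ (subst₂ _≤_ (sym (vℤ-Cden l n)) (sym (vℤ-fact (suc l ℕ.* n)))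
    (Balanced-vₚU p∤Q n<N rank>l)))
  where
  open CatalanValuation P Q q p-prime U≢0
  n<N : n < suc l ℕ.* n
  n<N = subst (_≤ suc l ℕ.* n) (+-comm n 1) (+-monoʳ-≤ n (*-mono-≤ 1≤l 1≤n))
  rank>l : ∀ a → 1 ≤ a → + 2+ q ∣ U P Q a → l < a
  rank>l a 1≤a p∣Ua = <-≤-trans l<r (≮⇒≥ λ a<r → below-rank a 1≤a a<r p∣Ua)
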